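{- Let $n\ge33$ and let $\lambda\in P(n)$ be a partition at which $N(0,3;\lambda)$ attains its maximum over $P(n)$. Suppose $a_1\ge a_2\ge\dots\ge a_l$ ($l\ge1$) are parts of $\lambda$ (a sub-multiset of its parts, counted with multiplicity), none equal to $7$. Then $(a_1,\dots,a_l)$ is one of $(10),(13),(13,10),(13,13),(13,13,10),(13,13,13)$.
   Context: $P(n)$ is the set of partitions of $n$. $N(0,3;m)$ is the number of partitions of $m$ whose rank (largest part minus number of parts) is divisible by $3$, and for $\lambda=(\lambda_1,\dots,\lambda_k)$, $N(0,3;\lambda):=\prod_{j=1}^kN(0,3;\lambda_j)$. -}

module Defs where

open import Data.Nat using (ℕ; zero; suc; _+_; _*_; _∸_; _≤_; _≥_; _⊓_; _⊔_)
open import Data.List using (List; []; _∷_; [_]; map; concatMap; upTo; length; filter; foldr)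
open import Data.Nat.ListAction using (sum; product)
open import Data.Product using (_×_)
open import Data.List.Relation.Unary.All using (All)
open import Data.List.Relation.Unary.Linked using (Linked)
open import Data.Integer using (ℤ; +_; _-_)
open import Data.Integer.Divisibility.Signed using (_∣?_)
open import Relation.Binary.PropositionalEquality using (_≡_)

IsPartition : ℕ → List ℕ → Set
IsPartition n λs = (sum λs ≡ n) × All (λ x → 1 ≤ x) λs × Linked _≥_ λs

-- Enumeration of partitions of n with all parts ≤ k (non-increasing lists of
-- positive parts); the first argument is fuel (fuel ≥ n suffices).
partsLE : ℕ → ℕ → ℕ → List (List ℕ)
partsLE _ zero _ = [ [] ]
partsLE zero (suc n) _ = []
partsLE (suc f) (suc n) k =
  concatMap (λ j → map (j ∷_) (partsLE f (suc n ∸ j) j)) (map suc (upTo (k ⊓ suc n)))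

P : ℕ → List (List ℕ)
P m = partsLE m m m

largestPart : List ℕ → ℕ
largestPart = foldr _⊔_ 0

rank : List ℕ → ℤ
rank μ = + largestPart μ - + length μ

N03 : ℕ → ℕ
N03 m = length (filter (λ μ → (+ 3) ∣? rank μ) (P m))

N03-part : List ℕ → ℕ
N03-part λs = product (map N03 λs)

-- If S ⊆ λ and R is a multiset of positive parts with the
-- same sum and N(0,3;S) < N(0,3;R), exchanging S for R would increase N(0,3;λ), because the
-- remaining factor N(0,3;λ ∖ S) is nonzero (N(0,3;λ) ≥ N(0,3;1ⁿ) = 1).  A part x ≥ 34 is ruled
-- out by N(0,3;x) ≤ p(x) < N(0,3;7^a 10^b 13^c) for some 7a + 10b + 13c = x, using a computed
-- table of p up to 110 and p(x) ≤ 324 (5/4)^x beyond.  Exchanges among the parts below 34,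
-- each checked by evaluation, leave only 1, 3, 4, 6, 7, 9, 10, 13 and 16; when one of 1, 3, 4,
-- 6, 9, 16 occurs, further exchanges bound every count so tightly that λ weighs less than 33.
-- What remains is 7s with at most one 10 and at most three 13s, never both a 10 and three 13s.

{-# OPTIONS --safe #-}
module Submission where

open import Defs
open import Data.Nat
open import Data.Nat.Properties
open import Data.Nat.Induction using (<-rec)
open import Data.Nat.DivMod using (_/_; _%_; m%n<n; m≡m%n+[m/n]*n)
open import Data.Nat.Solver using (module +-*-Solver)
open +-*-Solver using (solve; _:*_; _:+_; con; _:=_)
open import Data.Nat.ListAction using (sum; product)
open import Data.Nat.ListAction.Properties using (sum-++; sum-↭; product-++; product-↭)
open import Data.Bool using (Bool; T; _∧_; _∨_; if_then_else_)
open import Data.Bool.Properties using (T-∧; T-∨)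
open import Data.Bool.ListAction using (all; any)
open import Data.List
  using (List; []; _∷_; [_]; _++_; map; concatMap; upTo; length; filter; replicate; reverse; zipWith; cartesianProduct)
open import Data.List.Properties
  using ( length-map; length-++; map-++; map-∘; map-cong; upTo-∷ʳ
        ; length-filter; filter-++; filter-accept; filter-reject; filter-some; filter-none)
open import Data.List.Relation.Unary.All as All using (All; []; _∷_)
open import Data.List.Relation.Unary.All.Properties using (all⁺; ++⁺; ++⁻ʳ; ¬Any⇒All¬)
open import Data.List.Relation.Unary.Any as Any using (here; there; any?)
open import Data.List.Relation.Unary.Any.Properties using (any⁻)
open import Data.List.Relation.Unary.Linked using (Linked; []; [-]; _∷_)
open import Data.List.Relation.Binary.Pointwise using (Pointwise; []; _∷_)
open import Data.List.Membership.Propositional using (_∈_)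
open import Data.List.Membership.Propositional.Properties
  using (∈-upTo⁺; ∈-cartesianProduct⁺; ∈-∃++; ∈-++⁺ˡ; ∈-++⁻)
open import Data.List.Relation.Binary.Permutation.Propositional using (_↭_; ↭-refl; ↭-sym; ↭-trans; ↭-prep)
open import Data.List.Relation.Binary.Permutation.Propositional.Properties
  using (↭-length; filter-↭; shift; ++⁺ˡ; ++-assoc; All-resp-↭; map⁺; ∈-resp-↭)
import Relation.Binary.Construct.Flip.EqAndOrd as Flip
open import Data.List.Sort (Flip.decTotalOrder ≤-decTotalOrder) using (sort; sort-↭; sort-↗)
open import Data.Product using (∃; _×_; _,_; proj₁; proj₂)
open import Data.Sum using (_⊎_; inj₁; inj₂; [_,_]′)
open import Data.Empty using (⊥; ⊥-elim)
open import Function using (_∘_; id)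
open import Function.Bundles using (Equivalence)
open import Relation.Nullary using (¬_; yes; no; contradiction)
open import Relation.Binary.PropositionalEquality hiding ([_])

length-concatMap : {A B : Set} (f : A → List B) (xs : List A) →
                   length (concatMap f xs) ≡ sum (map (length ∘ f) xs)
length-concatMap f []       = refl
length-concatMap f (x ∷ xs) =
  trans (length-++ (f x)) (cong (length (f x) +_) (length-concatMap f xs))

sumUpTo : (ℕ → ℕ) → ℕ → ℕ
sumUpTo g t = sum (map g (upTo t))

sumUpTo-suc : ∀ g t → sumUpTo g (suc t) ≡ sumUpTo g t + g t
sumUpTo-suc g t = begin
  sum (map g (upTo (suc t)))       ≡⟨ cong (sum ∘ map g) (upTo-∷ʳ t) ⟨
  sum (map g (upTo t ++ [ t ]))    ≡⟨ cong sum (map-++ g (upTo t) [ t ]) ⟩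
  sum (map g (upTo t) ++ [ g t ])  ≡⟨ sum-++ (map g (upTo t)) [ g t ] ⟩
  sumUpTo g t + (g t + 0)          ≡⟨ cong (sumUpTo g t +_) (+-identityʳ (g t)) ⟩
  sumUpTo g t + g t                ∎
  where open ≡-Reasoning

sumUpTo-cong : ∀ {g h} t → (∀ i → i < t → g i ≡ h i) → sumUpTo g t ≡ sumUpTo h t
sumUpTo-cong zero    g≡h = refl
sumUpTo-cong {g} {h} (suc t) g≡h = begin
  sumUpTo g (suc t)  ≡⟨ sumUpTo-suc g t ⟩
  sumUpTo g t + g t  ≡⟨ cong₂ _+_ (sumUpTo-cong t (λ i i<t → g≡h i (m<n⇒m<1+n i<t))) (g≡h t ≤-refl) ⟩
  sumUpTo h t + h t  ≡⟨ sumUpTo-suc h t ⟨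
  sumUpTo h (suc t)  ∎
  where open ≡-Reasoning

#partsLE : ℕ → ℕ → ℕ → ℕ
#partsLE fuel n k = length (partsLE fuel n k)

#partsLE-suc : ∀ f n k →
  #partsLE (suc f) (suc n) k ≡ sumUpTo (λ i → #partsLE f (n ∸ i) (suc i)) (k ⊓ suc n)
#partsLE-suc f n k = begin
  length (concatMap extend (map suc (upTo (k ⊓ suc n))))
    ≡⟨ length-concatMap extend (map suc (upTo (k ⊓ suc n))) ⟩
  sum (map (length ∘ extend) (map suc (upTo (k ⊓ suc n))))
    ≡⟨ cong sum (map-∘ (upTo (k ⊓ suc n))) ⟨
  sum (map (length ∘ extend ∘ suc) (upTo (k ⊓ suc n)))
    ≡⟨ cong sum (map-cong (λ i → length-map (suc i ∷_) (partsLE f (n ∸ i) (suc i))) (upTo (k ⊓ suc n))) ⟩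
  sumUpTo (λ i → #partsLE f (n ∸ i) (suc i)) (k ⊓ suc n) ∎
  where
  open ≡-Reasoning
  extend : ℕ → List (List ℕ)
  extend j = map (j ∷_) (partsLE f (suc n ∸ j) j)

#partsLE-fuel : ∀ f g n k → n ≤ f → n ≤ g → #partsLE f n k ≡ #partsLE g n k
#partsLE-fuel f       g       zero    k _         _         = refl
#partsLE-fuel (suc f) (suc g) (suc n) k (s≤s n≤f) (s≤s n≤g) = begin
  #partsLE (suc f) (suc n) k                             ≡⟨ #partsLE-suc f n k ⟩
  sumUpTo (λ i → #partsLE f (n ∸ i) (suc i)) (k ⊓ suc n) ≡⟨ sumUpTo-cong (k ⊓ suc n) fuel-irrelevant ⟩
  sumUpTo (λ i → #partsLE g (n ∸ i) (suc i)) (k ⊓ suc n) ≡⟨ #partsLE-suc g n k ⟨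
  #partsLE (suc g) (suc n) k                             ∎
  where
  open ≡-Reasoning
  fuel-irrelevant : ∀ i → i < k ⊓ suc n → #partsLE f (n ∸ i) (suc i) ≡ #partsLE g (n ∸ i) (suc i)
  fuel-irrelevant i _ = #partsLE-fuel f g (n ∸ i) (suc i)
    (≤-trans (m∸n≤m n i) n≤f) (≤-trans (m∸n≤m n i) n≤g)

p : ℕ → ℕ → ℕ
p n k = #partsLE n n k

p-suc : ∀ n k → p (suc n) k ≡ sumUpTo (λ i → p (n ∸ i) (suc i)) (k ⊓ suc n)
p-suc n k = trans (#partsLE-suc n n k) (sumUpTo-cong (k ⊓ suc n)
  (λ i _ → #partsLE-fuel n (n ∸ i) (n ∸ i) (suc i) (m∸n≤m n i) ≤-refl))

p-saturate : ∀ {n k} → n ≤ k → p n k ≡ p n n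
p-saturate {zero}  _   = refl
p-saturate {suc n} {k} n≤k = begin
  p (suc n) k                                          ≡⟨ p-suc n k ⟩
  sumUpTo (λ i → p (n ∸ i) (suc i)) (k ⊓ suc n)       ≡⟨ cong (sumUpTo _) (trans (m≥n⇒m⊓n≡n n≤k) (sym (⊓-idem (suc n)))) ⟩
  sumUpTo (λ i → p (n ∸ i) (suc i)) (suc n ⊓ suc n)   ≡⟨ p-suc n (suc n) ⟨
  p (suc n) (suc n)                                    ∎
  where open ≡-Reasoning

p-suc-saturate : ∀ {m k} → m ≤ k → p m (suc k) ≡ p m k
p-suc-saturate m≤k = trans (p-saturate (m≤n⇒m≤1+n m≤k)) (sym (p-saturate m≤k))

p-recurrence : ∀ r k → p (r + suc k) (suc k) ≡ p (r + suc k) k + p r (suc k)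
p-recurrence r k rewrite +-suc r k = begin
  p (suc (r + k)) (suc k)                 ≡⟨ p-suc (r + k) (suc k) ⟩
  sumUpTo H (suc k ⊓ suc (r + k))        ≡⟨ cong (sumUpTo H) (m≤n⇒m⊓n≡m (s≤s (m≤n+m k r))) ⟩
  sumUpTo H (suc k)                       ≡⟨ sumUpTo-suc H k ⟩
  sumUpTo H k + H k                       ≡⟨ cong₂ _+_ drop-last (cong (λ x → p x (suc k)) (m+n∸n≡m r k)) ⟩
  p (suc (r + k)) k + p r (suc k)         ∎
  where
  open ≡-Reasoning
  H : ℕ → ℕ
  H i = p (r + k ∸ i) (suc i)
  drop-last : sumUpTo H k ≡ p (suc (r + k)) k
  drop-last = trans (cong (sumUpTo H) (sym (m≤n⇒m⊓n≡m (m≤n⇒m≤1+n (m≤n+m k r)))))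
                    (sym (p-suc (r + k) k))

p-induction : ∀ k (P : ℕ → ℕ → Set)
  → (∀ m → m ≤ k → P m (p m k))
  → (∀ r → P r (p r (suc k)) → P (r + suc k) (p (r + suc k) k + p r (suc k)))
  → ∀ m → P m (p m (suc k))
p-induction k P small step = <-rec (λ m → P m (p m (suc k))) go
  where
  go : ∀ m → (∀ {r} → r < m → P r (p r (suc k))) → P m (p m (suc k))
  go m rec with m ≤? k
  ... | yes m≤k = subst (P m) (sym (p-suc-saturate m≤k)) (small m m≤k)
  ... | no  m≰k = subst (λ x → P x (p x (suc k))) m≡r+k+1
                    (subst (P (r + suc k)) (sym (p-recurrence r k)) (step r (rec r<m)))
    where
    r = m ∸ suc k
    k<m : suc k ≤ m
    k<m = ≰⇒> m≰k
    m≡r+k+1 : r + suc k ≡ m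
    m≡r+k+1 = m∸n+n≡m k<m
    r<m : r < m
    r<m = subst (r <_) m≡r+k+1 (m<m+n r z<s)

nth : {A : Set} → A → List A → ℕ → A
nth d []       _       = d
nth d (x ∷ _)  zero    = x
nth d (_ ∷ xs) (suc i) = nth d xs i

-- Checked Booleans are turned into proofs only through these lemmas: applying ≤ᵇ⇒≤ or
-- <ᵇ⇒< to f x and g x for an open x would make Agda evaluate them during unification.
module _ {A : Set} (f g : A → ℕ) where

  all≤ᵇ⇒All≤ : ∀ xs → T (all (λ x → f x ≤ᵇ g x) xs) → All (λ x → f x ≤ g x) xs
  all≤ᵇ⇒All≤ xs holds = All.map (λ {x} → ≤ᵇ⇒≤ (f x) (g x)) (all⁺ _ xs holds)

  all<ᵇ⇒All< : ∀ xs → T (all (λ x → f x <ᵇ g x) xs) → All (λ x → f x < g x) xs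
  all<ᵇ⇒All< xs holds = All.map (λ {x} → <ᵇ⇒< (f x) (g x)) (all⁺ _ xs holds)

-- p(m, k) ≤ a (5/4)^m, the value of the generating function ∏_{j ≤ k} (1 − x^j)⁻¹ at x = 4/5.
ExpBound : ℕ → ℕ → Set
ExpBound k a = ∀ m → p m k * 4 ^ m ≤ a * 5 ^ m

expBound-suc : ∀ {k a a'} → a * 5 ^ suc k + a' * 4 ^ suc k ≤ a' * 5 ^ suc k →
               ExpBound k a → ExpBound (suc k) a'
expBound-suc {k} {a} {a'} growth bound = p-induction k (λ m v → v * 4 ^ m ≤ a' * 5 ^ m) small step
  where
  a≤a' : a ≤ a'
  a≤a' = *-cancelʳ-≤ a a' (5 ^ suc k) {{m^n≢0 5 (suc k)}} (m+n≤o⇒m≤o _ growth)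

  small : ∀ m → m ≤ k → p m k * 4 ^ m ≤ a' * 5 ^ m
  small m _ = ≤-trans (bound m) (*-monoˡ-≤ (5 ^ m) a≤a')

  step : ∀ r → p r (suc k) * 4 ^ r ≤ a' * 5 ^ r →
         (p (r + suc k) k + p r (suc k)) * 4 ^ (r + suc k) ≤ a' * 5 ^ (r + suc k)
  step r ih = begin
    (X + Y) * 4 ^ (r + suc k)                 ≡⟨ cong ((X + Y) *_) (^-distribˡ-+-* 4 r (suc k)) ⟩
    (X + Y) * (x * u)                         ≡⟨ solve 4 (λ X Y x u → (X :+ Y) :* (x :* u) := X :* (x :* u) :+ (Y :* x) :* u) refl X Y x u ⟩
    X * (x * u) + (Y * x) * u                 ≤⟨ +-mono-≤ hX (*-monoˡ-≤ u ih) ⟩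
    a * (y * v) + (a' * y) * u                ≡⟨ solve 5 (λ a a' y v u → a :* (y :* v) :+ (a' :* y) :* u := y :* (a :* v :+ a' :* u)) refl a a' y v u ⟩
    y * (a * v + a' * u)                      ≤⟨ *-monoʳ-≤ y growth ⟩
    y * (a' * v)                              ≡⟨ solve 3 (λ y a' v → y :* (a' :* v) := a' :* (y :* v)) refl y a' v ⟩
    a' * (y * v)                              ≡⟨ cong (a' *_) (^-distribˡ-+-* 5 r (suc k)) ⟨
    a' * 5 ^ (r + suc k)                      ∎
    where
    open ≤-Reasoning
    X = p (r + suc k) k
    Y = p r (suc k)
    x = 4 ^ r
    u = 4 ^ suc k
    y = 5 ^ r
    v = 5 ^ suc k
    hX : X * (x * u) ≤ a * (y * v)
    hX = subst₂ (λ s t → X * s ≤ a * t) (^-distribˡ-+-* 4 r (suc k)) (^-distribˡ-+-* 5 r (suc k))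
                (bound (r + suc k))

-- a₀ = 1 and a_{k+1} = ⌈a_k / (1 − (4/5)^{k+1})⌉.
expBoundCoefficients : List ℕ
expBoundCoefficients =
  1 ∷ 5 ∷ 14 ∷ 29 ∷ 50 ∷ 75 ∷ 102 ∷ 130 ∷ 157 ∷ 182 ∷ 204 ∷ 224 ∷ 241 ∷ 256 ∷ 268 ∷ 278 ∷ 287 ∷
  294 ∷ 300 ∷ 305 ∷ 309 ∷ []

expBoundCoefficient : ℕ → ℕ
expBoundCoefficient = nth 0 expBoundCoefficients

expBoundCoefficient-growth : ∀ {k} → k < 20 →
  expBoundCoefficient k * 5 ^ suc k + expBoundCoefficient (suc k) * 4 ^ suc k
    ≤ expBoundCoefficient (suc k) * 5 ^ suc k
expBoundCoefficient-growth k<20 = All.lookup growths (∈-upTo⁺ k<20)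
  where
  growths = all≤ᵇ⇒All≤ (λ k → expBoundCoefficient k * 5 ^ suc k + expBoundCoefficient (suc k) * 4 ^ suc k)
                       (λ k → expBoundCoefficient (suc k) * 5 ^ suc k) (upTo 20) _

expBound≤20 : ∀ k → k ≤ 20 → ExpBound k (expBoundCoefficient k)
expBound≤20 zero    _    zero    = ≤-refl
expBound≤20 zero    _    (suc m) = z≤n
expBound≤20 (suc k) k<20 =
  expBound-suc {a = expBoundCoefficient k} {expBoundCoefficient (suc k)}
    (expBoundCoefficient-growth k<20) (expBound≤20 k (<⇒≤ k<20))

-- p(m, k) (4/5)^m ≤ M (1 − 4 (4/5)^k), cleared of denominators.  It survives the
-- recurrence from k to k + 1 because 4 (4/5)^k − (4/5)^{k+1} = 4 (4/5)^{k+1}.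
TailBound : ℕ → ℕ → Set
TailBound M k = ∀ m → p m k * 4 ^ m * 5 ^ k + M * 4 ^ suc k * 5 ^ m ≤ M * 5 ^ k * 5 ^ m

tailBound-suc : ∀ {M k} → TailBound M k → TailBound M (suc k)
tailBound-suc {M} {k} bound =
  p-induction k (λ m v → v * 4 ^ m * 5 ^ suc k + M * 4 ^ suc (suc k) * 5 ^ m ≤ M * 5 ^ suc k * 5 ^ m) small step
  where
  weaken : ∀ P x u y w → P * x * w + M * u * y ≤ M * w * y →
           P * x * (5 * w) + M * (4 * u) * y ≤ M * (5 * w) * y
  weaken P x u y w h = begin
    P * x * (5 * w) + M * (4 * u) * y  ≤⟨ +-monoʳ-≤ (P * x * (5 * w)) (*-monoˡ-≤ y (*-monoʳ-≤ M (*-monoˡ-≤ u (n≤1+n 4)))) ⟩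
    P * x * (5 * w) + M * (5 * u) * y  ≡⟨ solve 6 (λ P M x u y w → P :* x :* (con 5 :* w) :+ M :* (con 5 :* u) :* y := con 5 :* (P :* x :* w :+ M :* u :* y)) refl P M x u y w ⟩
    5 * (P * x * w + M * u * y)        ≤⟨ *-monoʳ-≤ 5 h ⟩
    5 * (M * w * y)                    ≡⟨ solve 3 (λ M w y → con 5 :* (M :* w :* y) := M :* (con 5 :* w) :* y) refl M w y ⟩
    M * (5 * w) * y                    ∎
    where open ≤-Reasoning

  small : ∀ m → m ≤ k → p m k * 4 ^ m * 5 ^ suc k + M * 4 ^ suc (suc k) * 5 ^ m ≤ M * 5 ^ suc k * 5 ^ m
  small m _ = weaken (p m k) (4 ^ m) (4 ^ suc k) (5 ^ m) (5 ^ k) (bound m)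

  combine : ∀ A B x u y w
    → A * (x * u) * w + M * u * (y * (5 * w)) ≤ M * w * (y * (5 * w))
    → B * x * (5 * w) + M * (4 * u) * y ≤ M * (5 * w) * y
    → (A + B) * (x * u) * (5 * w) + M * (4 * u) * (y * (5 * w)) ≤ M * (5 * w) * (y * (5 * w))
  combine A B x u y w hA hB = +-cancelʳ-≤ (M * u * y * (5 * w) + 4 * (M * u * u * y)) _ _ (begin
    (A + B) * (x * u) * (5 * w) + M * (4 * u) * (y * (5 * w)) + (M * u * y * (5 * w) + 4 * (M * u * u * y))
      ≡⟨ solve 7 (λ A B M x u y w → (A :+ B) :* (x :* u) :* (con 5 :* w) :+ M :* (con 4 :* u) :* (y :* (con 5 :* w)) :+ (M :* u :* y :* (con 5 :* w) :+ con 4 :* (M :* u :* u :* y))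
               := con 5 :* (A :* (x :* u) :* w :+ M :* u :* (y :* (con 5 :* w))) :+ u :* (B :* x :* (con 5 :* w) :+ M :* (con 4 :* u) :* y)) refl A B M x u y w ⟩
    5 * (A * (x * u) * w + M * u * (y * (5 * w))) + u * (B * x * (5 * w) + M * (4 * u) * y)
      ≤⟨ +-mono-≤ (*-monoʳ-≤ 5 hA) (*-monoʳ-≤ u hB) ⟩
    5 * (M * w * (y * (5 * w))) + u * (M * (5 * w) * y)
      ≡⟨ solve 4 (λ M u y w → con 5 :* (M :* w :* (y :* (con 5 :* w))) :+ u :* (M :* (con 5 :* w) :* y) := M :* (con 5 :* w) :* (y :* (con 5 :* w)) :+ M :* u :* y :* (con 5 :* w)) refl M u y w ⟩
    M * (5 * w) * (y * (5 * w)) + M * u * y * (5 * w)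
      ≤⟨ +-monoʳ-≤ (M * (5 * w) * (y * (5 * w))) (m≤m+n (M * u * y * (5 * w)) (4 * (M * u * u * y))) ⟩
    M * (5 * w) * (y * (5 * w)) + (M * u * y * (5 * w) + 4 * (M * u * u * y)) ∎)
    where open ≤-Reasoning

  step : ∀ r → p r (suc k) * 4 ^ r * 5 ^ suc k + M * 4 ^ suc (suc k) * 5 ^ r ≤ M * 5 ^ suc k * 5 ^ r →
         (p (r + suc k) k + p r (suc k)) * 4 ^ (r + suc k) * 5 ^ suc k + M * 4 ^ suc (suc k) * 5 ^ (r + suc k)
           ≤ M * 5 ^ suc k * 5 ^ (r + suc k)
  step r ih = subst₂ (λ s t → (X + Y) * s * 5 ^ suc k + M * 4 ^ suc (suc k) * t ≤ M * 5 ^ suc k * t)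
                (sym (^-distribˡ-+-* 4 r (suc k))) (sym (^-distribˡ-+-* 5 r (suc k)))
                (combine X Y (4 ^ r) (4 ^ suc k) (5 ^ r) (5 ^ k) hX ih)
    where
    X = p (r + suc k) k
    Y = p r (suc k)
    hX : X * (4 ^ r * 4 ^ suc k) * 5 ^ k + M * 4 ^ suc k * (5 ^ r * 5 ^ suc k) ≤ M * 5 ^ k * (5 ^ r * 5 ^ suc k)
    hX = subst₂ (λ s t → X * s * 5 ^ k + M * 4 ^ suc k * t ≤ M * 5 ^ k * t)
           (^-distribˡ-+-* 4 r (suc k)) (^-distribˡ-+-* 5 r (suc k)) (bound (r + suc k))

tailBound-20 : TailBound 324 20
tailBound-20 m = begin
  p m 20 * 4 ^ m * 5 ^ 20 + 324 * 4 ^ 21 * 5 ^ m    ≤⟨ +-monoˡ-≤ _ (*-monoˡ-≤ (5 ^ 20) (expBound≤20 20 ≤-refl m)) ⟩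
  309 * 5 ^ m * 5 ^ 20 + 324 * 4 ^ 21 * 5 ^ m       ≡⟨ solve 1 (λ y → con 309 :* y :* con (5 ^ 20) :+ con (324 * 4 ^ 21) :* y := (con (309 * 5 ^ 20) :+ con (324 * 4 ^ 21)) :* y) refl (5 ^ m) ⟩
  (309 * 5 ^ 20 + 324 * 4 ^ 21) * 5 ^ m             ≤⟨ *-monoˡ-≤ (5 ^ m) (≤ᵇ⇒≤ (309 * 5 ^ 20 + 324 * 4 ^ 21) (324 * 5 ^ 20) _) ⟩
  324 * 5 ^ 20 * 5 ^ m                              ∎
  where open ≤-Reasoning

tailBound≥20 : ∀ {k} → 20 ≤ k → TailBound 324 k
tailBound≥20 {k} 20≤k = subst (TailBound 324) (m∸n+n≡m 20≤k) (go (k ∸ 20))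
  where
  go : ∀ j → TailBound 324 (j + 20)
  go zero    = tailBound-20
  go (suc j) = tailBound-suc {324} {j + 20} (go j)

p-exp-bound : ∀ {m} → 20 ≤ m → p m m * 4 ^ m ≤ 324 * 5 ^ m
p-exp-bound {m} 20≤m = *-cancelʳ-≤ _ _ (5 ^ m) {{m^n≢0 5 m}}
  (m+n≤o⇒m≤o (p m m * 4 ^ m * 5 ^ m) (tailBound≥20 20≤m m))

module _ (N : ℕ) (t : ℕ → ℕ → ℕ)
         (t-saturate : ∀ {n k} → n ≤ k → t n k ≡ t n n)
         (t-zero : 1 ≤ t 0 0)
         (t-recurrence : ∀ r k → r + suc k ≤ N → t (r + suc k) k + t r (suc k) ≤ t (r + suc k) (suc k))
  where

  p≤table : ∀ k m → m ≤ N → p m k ≤ t m k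
  p≤table zero    zero    _ = t-zero
  p≤table zero    (suc m) _ = z≤n
  p≤table (suc k) = p-induction k (λ m v → m ≤ N → v ≤ t m (suc k)) small step
    where
    small : ∀ m → m ≤ k → m ≤ N → p m k ≤ t m (suc k)
    small m m≤k m≤N = begin
      p m k        ≤⟨ p≤table k m m≤N ⟩
      t m k        ≡⟨ t-saturate m≤k ⟩
      t m m        ≡⟨ t-saturate (m≤n⇒m≤1+n m≤k) ⟨
      t m (suc k)  ∎
      where open ≤-Reasoning
    step : ∀ r → (r ≤ N → p r (suc k) ≤ t r (suc k)) →
           r + suc k ≤ N → p (r + suc k) k + p r (suc k) ≤ t (r + suc k) (suc k)
    step r ih m≤N = ≤-trans
      (+-mono-≤ (p≤table k (r + suc k) m≤N) (ih (m+n≤o⇒m≤o r m≤N)))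
      (t-recurrence r k m≤N)

-- Rows n, n − 1, …, 0 of the table of p, row j being p j 0 ∷ … ∷ p j j, computed
-- by the recurrence.  Nothing is proved about this table: only the inequalities
-- checked by recurrenceHolds are used.
pRowsDownFrom : ℕ → List (List ℕ)
pRowsDownFrom zero    = (1 ∷ []) ∷ []
pRowsDownFrom (suc n) = withNextRow (pRowsDownFrom n)
  where
  withNextRow : List (List ℕ) → List (List ℕ)
  withNextRow rows = row 0 0 (suc n) ∷ rows
    where
    row : ℕ → ℕ → ℕ → List ℕ
    row k acc zero    = acc ∷ []
    row k acc (suc j) = acc ∷ row (suc k) (acc + nth 0 (nth [] rows k) (suc k ⊓ (n ∸ k))) j

entry : List (List ℕ) → ℕ → ℕ → ℕ
entry rows n k = nth 0 (nth [] rows n) (k ⊓ n)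

entry-saturate : ∀ rows {n k} → n ≤ k → entry rows n k ≡ entry rows n n
entry-saturate rows {n} n≤k = cong (nth 0 (nth [] rows n)) (trans (m≥n⇒m⊓n≡n n≤k) (sym (⊓-idem n)))

recurrenceHolds : List (List ℕ) → ℕ → Bool
recurrenceHolds rows N =
  all (λ k → all (λ r → entry rows (r + suc k) k + entry rows r (suc k) ≤ᵇ entry rows (r + suc k) (suc k))
                 (upTo (suc (N ∸ suc k))))
      (upTo N)

recurrenceHolds-sound : ∀ rows N → T (recurrenceHolds rows N) → ∀ r k → r + suc k ≤ N →
  entry rows (r + suc k) k + entry rows r (suc k) ≤ entry rows (r + suc k) (suc k)
recurrenceHolds-sound rows N holds r k r+k<N =
  ≤ᵇ⇒≤ _ _ (All.lookup (all⁺ _ _ (All.lookup (all⁺ _ _ holds) (∈-upTo⁺ k<N)))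
                        (∈-upTo⁺ (s≤s (m+n≤o⇒m≤o∸n r r+k<N))))
  where
  k<N : k < N
  k<N = m+n≤o⇒n≤o r r+k<N

pRows : List (List ℕ)
pRows = reverse (pRowsDownFrom 110)

p≤pTable : ∀ {m} → m ≤ 110 → p m m ≤ entry pRows m m
p≤pTable {m} = p≤table 110 (entry pRows) (entry-saturate pRows) (s≤s z≤n)
  (recurrenceHolds-sound pRows 110 _) m m

N03≤p : ∀ m → N03 m ≤ p m m
N03≤p m = length-filter _ (P m)

N03-part-++ : ∀ xs ys → N03-part (xs ++ ys) ≡ N03-part xs * N03-part ys
N03-part-++ xs ys = trans (cong product (map-++ N03 xs ys)) (product-++ (map N03 xs) (map N03 ys))

N03-part-replicate : ∀ a x → N03-part (replicate a x) ≡ N03 x ^ a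
N03-part-replicate zero    x = refl
N03-part-replicate (suc a) x = cong (N03 x *_) (N03-part-replicate a x)

sum-replicate : ∀ a x → sum (replicate a x) ≡ a * x
sum-replicate zero    x = refl
sum-replicate (suc a) x = cong (x +_) (sum-replicate a x)

replicate-positive : ∀ a {x} → 1 ≤ x → All (1 ≤_) (replicate a x)
replicate-positive zero    _   = []
replicate-positive (suc a) 1≤x = 1≤x ∷ replicate-positive a 1≤x

-- The multiset 7^a 10^b 13^c.  N(0,3;7) = 7, N(0,3;10) = 16 and N(0,3;13) = 37
-- (found by evaluation in N03-part-parts) make these the most valuable parts per unit of size.
record Shape : Set where
  constructor ⟨_,_,_⟩
  field
    sevens tens thirteens : ℕ

open Shape

parts : Shape → List ℕ
parts σ = replicate (sevens σ) 7 ++ replicate (tens σ) 10 ++ replicate (thirteens σ) 13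

weight : Shape → ℕ
weight σ = 7 * sevens σ + 10 * tens σ + 13 * thirteens σ

value : Shape → ℕ
value σ = 7 ^ sevens σ * 16 ^ tens σ * 37 ^ thirteens σ

sum-parts : ∀ σ → sum (parts σ) ≡ weight σ
sum-parts ⟨ a , b , c ⟩ = begin
  sum (replicate a 7 ++ replicate b 10 ++ replicate c 13)
    ≡⟨ sum-++ (replicate a 7) _ ⟩
  sum (replicate a 7) + sum (replicate b 10 ++ replicate c 13)
    ≡⟨ cong (sum (replicate a 7) +_) (sum-++ (replicate b 10) _) ⟩
  sum (replicate a 7) + (sum (replicate b 10) + sum (replicate c 13))
    ≡⟨ cong₂ _+_ (sum-replicate a 7) (cong₂ _+_ (sum-replicate b 10) (sum-replicate c 13)) ⟩
  a * 7 + (b * 10 + c * 13)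
    ≡⟨ solve 3 (λ a b c → a :* con 7 :+ (b :* con 10 :+ c :* con 13) := con 7 :* a :+ con 10 :* b :+ con 13 :* c) refl a b c ⟩
  weight ⟨ a , b , c ⟩ ∎
  where open ≡-Reasoning

N03-part-parts : ∀ σ → N03-part (parts σ) ≡ value σ
N03-part-parts ⟨ a , b , c ⟩ = begin
  N03-part (replicate a 7 ++ replicate b 10 ++ replicate c 13)
    ≡⟨ N03-part-++ (replicate a 7) _ ⟩
  N03-part (replicate a 7) * N03-part (replicate b 10 ++ replicate c 13)
    ≡⟨ cong (N03-part (replicate a 7) *_) (N03-part-++ (replicate b 10) _) ⟩
  N03-part (replicate a 7) * (N03-part (replicate b 10) * N03-part (replicate c 13))
    ≡⟨ cong₂ _*_ (N03-part-replicate a 7) (cong₂ _*_ (N03-part-replicate b 10) (N03-part-replicate c 13)) ⟩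
  7 ^ a * (16 ^ b * 37 ^ c)
    ≡⟨ *-assoc (7 ^ a) (16 ^ b) (37 ^ c) ⟨
  value ⟨ a , b , c ⟩ ∎
  where open ≡-Reasoning

parts-positive : ∀ σ → All (1 ≤_) (parts σ)
parts-positive σ = ++⁺ (replicate-positive (sevens σ) (s≤s z≤n))
                       (++⁺ (replicate-positive (tens σ) (s≤s z≤n)) (replicate-positive (thirteens σ) (s≤s z≤n)))

withSevens : ℕ → Shape → Shape
withSevens q σ = ⟨ q + sevens σ , tens σ , thirteens σ ⟩

weight-withSevens : ∀ q σ → weight (withSevens q σ) ≡ 7 * q + weight σ
weight-withSevens q ⟨ a , b , c ⟩ =
  solve 4 (λ q a b c → con 7 :* (q :+ a) :+ con 10 :* b :+ con 13 :* c := con 7 :* q :+ (con 7 :* a :+ con 10 :* b :+ con 13 :* c)) refl q a b c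

weight-withSevens-suc : ∀ q σ → weight (withSevens (suc q) σ) ≡ 7 + weight (withSevens q σ)
weight-withSevens-suc q ⟨ a , b , c ⟩ =
  solve 4 (λ q a b c → con 7 :* (con 1 :+ q :+ a) :+ con 10 :* b :+ con 13 :* c
                     := con 7 :+ (con 7 :* (q :+ a) :+ con 10 :* b :+ con 13 :* c)) refl q a b c

value-withSevens-suc : ∀ q σ → value (withSevens (suc q) σ) ≡ 7 * value (withSevens q σ)
value-withSevens-suc q ⟨ a , b , c ⟩ =
  trans (cong (_* 37 ^ c) (*-assoc 7 (7 ^ (q + a)) (16 ^ b))) (*-assoc 7 (7 ^ (q + a) * 16 ^ b) (37 ^ c))

baseShape : ℕ → Shape
baseShape 0 = ⟨ 3 , 0 , 1 ⟩
baseShape 1 = ⟨ 5 , 0 , 0 ⟩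
baseShape 2 = ⟨ 0 , 1 , 2 ⟩
baseShape 3 = ⟨ 2 , 1 , 1 ⟩
baseShape 4 = ⟨ 4 , 1 , 0 ⟩
baseShape 5 = ⟨ 0 , 0 , 3 ⟩
baseShape _ = ⟨ 2 , 0 , 2 ⟩

weight-baseShape : ∀ {s} → s < 7 → weight (baseShape s) ≡ 34 + s
weight-baseShape {0} _ = refl
weight-baseShape {1} _ = refl
weight-baseShape {2} _ = refl
weight-baseShape {3} _ = refl
weight-baseShape {4} _ = refl
weight-baseShape {5} _ = refl
weight-baseShape {6} _ = refl
weight-baseShape {suc (suc (suc (suc (suc (suc (suc _))))))} (s≤s (s≤s (s≤s (s≤s (s≤s (s≤s (s≤s ())))))))

shapeOfWeight : ℕ → ℕ → Shape
shapeOfWeight q s = withSevens q (baseShape s)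

BeatsExpBound : Shape → Set
BeatsExpBound σ = 324 * 5 ^ weight σ < 4 ^ weight σ * value σ

5^7≤7*4^7 : 5 ^ 7 ≤ 7 * 4 ^ 7
5^7≤7*4^7 = m≤m+n (5 ^ 7) 36563

beatsExpBound-+7 : ∀ w v → 324 * 5 ^ w < 4 ^ w * v → 324 * 5 ^ (7 + w) < 4 ^ (7 + w) * (7 * v)
beatsExpBound-+7 w v beats =
  subst₂ (λ s t → 324 * s < t * (7 * v)) (sym (^-distribˡ-+-* 5 7 w)) (sym (^-distribˡ-+-* 4 7 w))
         (grow (5 ^ 7) (4 ^ 7) (5 ^ w) (4 ^ w) {{m^n≢0 4 7}} 5^7≤7*4^7 beats)
  where
  -- Stated for variables a, b: unifying products of the literals 5 ^ 7 and 4 ^ 7 with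
  -- open terms would make Agda unfold the literals in unary.
  grow : ∀ a b x y .{{_ : NonZero b}} → a ≤ 7 * b → 324 * x < y * v → 324 * (a * x) < b * y * (7 * v)
  grow a b x y a≤7b x<yv = begin-strict
    324 * (a * x)      ≡⟨ solve 2 (λ a x → con 324 :* (a :* x) := a :* (con 324 :* x)) refl a x ⟩
    a * (324 * x)      ≤⟨ *-monoˡ-≤ (324 * x) a≤7b ⟩
    7 * b * (324 * x)  <⟨ *-monoʳ-< (7 * b) {{m*n≢0 7 b}} x<yv ⟩
    7 * b * (y * v)    ≡⟨ solve 3 (λ b y v → con 7 :* b :* (y :* v) := b :* y :* (con 7 :* v)) refl b y v ⟩
    b * y * (7 * v)    ∎
    where open ≤-Reasoning

beatsExpBound-suc : ∀ q σ → BeatsExpBound (withSevens q σ) → BeatsExpBound (withSevens (suc q) σ)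
beatsExpBound-suc q σ beats =
  subst₂ (λ w v → 324 * 5 ^ w < 4 ^ w * v) (sym (weight-withSevens-suc q σ)) (sym (value-withSevens-suc q σ))
         (beatsExpBound-+7 (weight (withSevens q σ)) (value (withSevens q σ)) beats)

beatsExpBound≥11 : ∀ q {s} → s < 7 → BeatsExpBound (shapeOfWeight (q + 11) s)
beatsExpBound≥11 zero    s<7 = All.lookup checked (∈-upTo⁺ s<7)
  where
  checked : All (λ s → BeatsExpBound (shapeOfWeight 11 s)) (upTo 7)
  checked = all<ᵇ⇒All< (λ s → 324 * 5 ^ weight (shapeOfWeight 11 s))
                       (λ s → 4 ^ weight (shapeOfWeight 11 s) * value (shapeOfWeight 11 s)) (upTo 7) _
beatsExpBound≥11 (suc q) {s} s<7 = beatsExpBound-suc (q + 11) (baseShape s) (beatsExpBound≥11 q s<7)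

tableBelowValue : ∀ {q s} → q < 11 → s < 7 →
  entry pRows (weight (shapeOfWeight q s)) (weight (shapeOfWeight q s)) < value (shapeOfWeight q s)
tableBelowValue q<11 s<7 = All.lookup checked (∈-cartesianProduct⁺ (∈-upTo⁺ q<11) (∈-upTo⁺ s<7))
  where
  checked = all<ᵇ⇒All< (λ qs → entry pRows (weight (shapeOfWeight (proj₁ qs) (proj₂ qs))) (weight (shapeOfWeight (proj₁ qs) (proj₂ qs))))
                       (λ qs → value (shapeOfWeight (proj₁ qs) (proj₂ qs))) (cartesianProduct (upTo 11) (upTo 7)) _

weight-shapeOfWeight : ∀ q {s} → s < 7 → weight (shapeOfWeight q s) ≡ 7 * q + (34 + s)
weight-shapeOfWeight q {s} s<7 = trans (weight-withSevens q (baseShape s)) (cong (7 * q +_) (weight-baseShape s<7))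

p<value : ∀ q {s} → s < 7 → p (weight (shapeOfWeight q s)) (weight (shapeOfWeight q s)) < value (shapeOfWeight q s)
p<value q {s} s<7 with q <? 11
... | yes q<11 = ≤-<-trans (p≤pTable w≤110) (tableBelowValue q<11 s<7)
  where
  w≤110 : weight (shapeOfWeight q s) ≤ 110
  w≤110 = subst (_≤ 110) (sym (weight-shapeOfWeight q s<7))
                (+-mono-≤ (*-monoʳ-≤ 7 (≤-pred q<11)) (+-monoʳ-≤ 34 (≤-pred s<7)))
... | no q≮11 = *-cancelʳ-< _ (p w w) v (begin-strict
  p w w * 4 ^ w   ≤⟨ p-exp-bound 20≤w ⟩
  324 * 5 ^ w     <⟨ subst (λ q → BeatsExpBound (shapeOfWeight q s)) (m∸n+n≡m (≮⇒≥ q≮11)) (beatsExpBound≥11 (q ∸ 11) s<7) ⟩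
  4 ^ w * v       ≡⟨ *-comm (4 ^ w) v ⟩
  v * 4 ^ w       ∎)
  where
  open ≤-Reasoning
  w = weight (shapeOfWeight q s)
  v = value (shapeOfWeight q s)
  20≤w : 20 ≤ w
  20≤w = subst (20 ≤_) (sym (weight-shapeOfWeight q s<7)) (≤-trans (m≤m+n 20 14) (≤-trans (m≤m+n 34 s) (m≤n+m (34 + s) (7 * q))))

count : ℕ → List ℕ → ℕ
count v xs = length (filter (v ≟_) xs)

count-++ : ∀ v xs ys → count v (xs ++ ys) ≡ count v xs + count v ys
count-++ v xs ys = trans (cong length (filter-++ (v ≟_) xs ys)) (length-++ (filter (v ≟_) xs))

count-↭ : ∀ v {xs ys} → xs ↭ ys → count v xs ≡ count v ys
count-↭ v xs↭ys = ↭-length (filter-↭ (v ≟_) xs↭ys)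

count-here : ∀ v xs → count v (v ∷ xs) ≡ suc (count v xs)
count-here v xs = cong length (filter-accept (v ≟_) refl)

count-∷ : ∀ v x xs → count v xs ≤ count v (x ∷ xs)
count-∷ v x xs with v ≟ x
... | yes v≡x = ≤-trans (n≤1+n _) (≤-reflexive (sym (cong length (filter-accept (v ≟_) v≡x))))
... | no  v≢x = ≤-reflexive (sym (cong length (filter-reject (v ≟_) v≢x)))

count-replicate-≢ : ∀ {v u} a → v ≢ u → count v (replicate a u) ≡ 0
count-replicate-≢ zero    _   = refl
count-replicate-≢ (suc a) v≢u = trans (cong length (filter-reject (_ ≟_) v≢u)) (count-replicate-≢ a v≢u)

∈⇒count-pos : ∀ {v xs} → v ∈ xs → 0 < count v xs
∈⇒count-pos {v} = filter-some (v ≟_)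

count-pos⇒∈ : ∀ {v xs} → 0 < count v xs → v ∈ xs
count-pos⇒∈ {v} {xs} pos with any? (v ≟_) xs
... | yes v∈xs = v∈xs
... | no  v∉xs = contradiction (cong length (filter-none (v ≟_) (¬Any⇒All¬ xs v∉xs))) (>⇒≢ pos)

infix 4 _⊆ₘ_
_⊆ₘ_ : List ℕ → List ℕ → Set
xs ⊆ₘ ys = ∃ λ rest → xs ++ rest ↭ ys

replicate-⊆ₘ : ∀ u a {xs} → a ≤ count u xs → replicate a u ⊆ₘ xs
replicate-⊆ₘ u zero    {xs} _ = xs , ↭-refl
replicate-⊆ₘ u (suc a) {xs} a<count with ∈-∃++ (count-pos⇒∈ {u} {xs} (<-≤-trans z<s a<count))
... | ys , zs , refl with replicate-⊆ₘ u a {ys ++ zs} a≤count′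
  where
  a≤count′ : a ≤ count u (ys ++ zs)
  a≤count′ = ≤-pred (subst (suc a ≤_) (trans (count-↭ u (shift u ys zs)) (count-here u (ys ++ zs))) a<count)
... | rest , perm = rest , ↭-trans (↭-prep u perm) (↭-sym (shift u ys zs))

∈⇒[]⊆ₘ : ∀ {x xs} → x ∈ xs → [ x ] ⊆ₘ xs
∈⇒[]⊆ₘ {x} x∈xs = replicate-⊆ₘ x 1 (∈⇒count-pos x∈xs)

replicate²-⊆ₘ : ∀ {u w} a b {xs} → u ≢ w → a ≤ count u xs → b ≤ count w xs →
                replicate a u ++ replicate b w ⊆ₘ xs
replicate²-⊆ₘ {u} {w} a b {xs} u≢w a≤ b≤ with replicate-⊆ₘ u a a≤
... | rest₁ , perm₁ with replicate-⊆ₘ w b {rest₁} b≤count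
  where
  b≤count : b ≤ count w rest₁
  b≤count = subst (b ≤_) (trans (sym (count-↭ w perm₁))
                                (trans (count-++ w (replicate a u) rest₁)
                                       (cong (_+ count w rest₁) (count-replicate-≢ a (u≢w ∘ sym)))))
                         b≤
... | rest₂ , perm₂ = rest₂ , ↭-trans (++-assoc (replicate a u) (replicate b w) rest₂)
                                      (↭-trans (++⁺ˡ (replicate a u) perm₂) perm₁)

weightedCount : List ℕ → List ℕ → ℕ
weightedCount vs xs = sum (map (λ v → v * count v xs) vs)

weightedCount-mono-∷ : ∀ vs x xs → weightedCount vs xs ≤ weightedCount vs (x ∷ xs)
weightedCount-mono-∷ []       x xs = z≤n
weightedCount-mono-∷ (v ∷ vs) x xs =
  +-mono-≤ (*-monoʳ-≤ v (count-∷ v x xs)) (weightedCount-mono-∷ vs x xs)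

weightedCount-∷ : ∀ {vs x} xs → x ∈ vs → x + weightedCount vs xs ≤ weightedCount vs (x ∷ xs)
weightedCount-∷ {x ∷ vs} xs (here refl) = begin
  x + (x * count x xs + weightedCount vs xs)   ≡⟨ +-assoc x _ _ ⟨
  x + x * count x xs + weightedCount vs xs     ≡⟨ cong (_+ weightedCount vs xs) (*-suc x (count x xs)) ⟨
  x * suc (count x xs) + weightedCount vs xs   ≡⟨ cong (λ c → x * c + weightedCount vs xs) (count-here x xs) ⟨
  x * count x (x ∷ xs) + weightedCount vs xs   ≤⟨ +-monoʳ-≤ _ (weightedCount-mono-∷ vs x xs) ⟩
  weightedCount (x ∷ vs) (x ∷ xs)              ∎
  where open ≤-Reasoning
weightedCount-∷ {v ∷ vs} {x} xs (there x∈vs) = begin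
  x + (v * count v xs + weightedCount vs xs)   ≡⟨ +-comm x _ ⟩
  v * count v xs + weightedCount vs xs + x     ≡⟨ +-assoc (v * count v xs) _ x ⟩
  v * count v xs + (weightedCount vs xs + x)   ≡⟨ cong (v * count v xs +_) (+-comm _ x) ⟩
  v * count v xs + (x + weightedCount vs xs)   ≤⟨ +-mono-≤ (*-monoʳ-≤ v (count-∷ v x xs)) (weightedCount-∷ xs x∈vs) ⟩
  weightedCount (v ∷ vs) (x ∷ xs)              ∎
  where open ≤-Reasoning

sum≤weightedCount : ∀ vs {xs} → All (_∈ vs) xs → sum xs ≤ weightedCount vs xs
sum≤weightedCount vs []                       = z≤n
sum≤weightedCount vs {x ∷ xs} (x∈vs ∷ xs⊆vs) =
  ≤-trans (+-monoʳ-≤ x (sum≤weightedCount vs xs⊆vs)) (weightedCount-∷ xs x∈vs)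

weightedCount≤ : ∀ {vs bs xs} → Pointwise (λ v b → count v xs ≤ b) vs bs →
                 weightedCount vs xs ≤ sum (zipWith _*_ vs bs)
weightedCount≤ []                          = z≤n
weightedCount≤ {v ∷ _} {xs = xs} (c≤b ∷ cs≤bs) = +-mono-≤ (*-monoʳ-≤ v c≤b) (weightedCount≤ {xs = xs} cs≤bs)

IsMaximal : ℕ → List ℕ → Set
IsMaximal n λs = (μ : List ℕ) → IsPartition n μ → N03-part μ ≤ N03-part λs

Improvement : List ℕ → List ℕ → Set
Improvement S R = sum R ≡ sum S × All (1 ≤_) R × N03-part S < N03-part R

improvement? : List ℕ → List ℕ → Bool
improvement? S R = (sum R ≡ᵇ sum S) ∧ all (1 ≤ᵇ_) R ∧ (N03-part S <ᵇ N03-part R)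

improvement?-sound : ∀ S R → T (improvement? S R) → Improvement S R
improvement?-sound S R holds with Equivalence.to T-∧ holds
... | sums , rest with Equivalence.to T-∧ rest
...   | positive , better =
  ≡ᵇ⇒≡ _ _ sums , All.map (≤ᵇ⇒≤ 1 _) (all⁺ _ R positive) , <ᵇ⇒< _ _ better

N03-part-↭ : ∀ {xs ys} → xs ↭ ys → N03-part xs ≡ N03-part ys
N03-part-↭ xs↭ys = product-↭ (map⁺ N03 xs↭ys)

ones-isPartition : ∀ n → IsPartition n (replicate n 1)
ones-isPartition n = trans (sum-replicate n 1) (*-identityʳ n) , replicate-positive n ≤-refl , decreasing n
  where
  decreasing : ∀ n → Linked _≥_ (replicate n 1)
  decreasing zero          = []
  decreasing (suc zero)    = [-]
  decreasing (suc (suc n)) = ≤-refl ∷ decreasing (suc n)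

N03-part-ones : ∀ n → N03-part (replicate n 1) ≡ 1
N03-part-ones zero    = refl
N03-part-ones (suc n) = cong (1 *_) (N03-part-ones n)

module _ {n λs} (isPartition : IsPartition n λs) (maximal : IsMaximal n λs) where

  maximal-positive : 0 < N03-part λs
  maximal-positive = subst (_≤ N03-part λs) (N03-part-ones n) (maximal (replicate n 1) (ones-isPartition n))

  -- Replacing S by R and sorting gives a partition μ of n with
  -- N(0,3;μ) = N(0,3;R) · N(0,3;rest) > N(0,3;S) · N(0,3;rest) = N(0,3;λ).
  maximal⇒¬improvement : ∀ {S R} → S ⊆ₘ λs → ¬ Improvement S R
  maximal⇒¬improvement {S} {R} (rest , S+rest↭λs) (sumR≡sumS , R-positive , S<R) =
    <⇒≱ (*-monoˡ-< (N03-part rest) {{rest-nonZero}} S<R) (subst₂ _≤_ N03-μ N03-λs (maximal μ μ-isPartition))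
    where
    μ = sort (R ++ rest)
    N03-λs : N03-part λs ≡ N03-part S * N03-part rest
    N03-λs = trans (sym (N03-part-↭ S+rest↭λs)) (N03-part-++ S rest)
    N03-μ : N03-part μ ≡ N03-part R * N03-part rest
    N03-μ = trans (N03-part-↭ (sort-↭ (R ++ rest))) (N03-part-++ R rest)
    rest-nonZero : NonZero (N03-part rest)
    rest-nonZero = m*n≢0⇒n≢0 (N03-part S) {{>-nonZero (subst (0 <_) N03-λs maximal-positive)}}
    sum-μ : sum μ ≡ n
    sum-μ = begin
      sum μ              ≡⟨ sum-↭ (sort-↭ (R ++ rest)) ⟩
      sum (R ++ rest)    ≡⟨ sum-++ R rest ⟩
      sum R + sum rest   ≡⟨ cong (_+ sum rest) sumR≡sumS ⟩
      sum S + sum rest   ≡⟨ sum-++ S rest ⟨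
      sum (S ++ rest)    ≡⟨ sum-↭ S+rest↭λs ⟩
      sum λs             ≡⟨ proj₁ isPartition ⟩
      n                  ∎
      where open ≡-Reasoning
    μ-isPartition : IsPartition n μ
    μ-isPartition = sum-μ
                  , All-resp-↭ (↭-sym (sort-↭ (R ++ rest)))
                               (++⁺ R-positive (++⁻ʳ S (All-resp-↭ (↭-sym S+rest↭λs) (proj₁ (proj₂ isPartition)))))
                  , sort-↗ (R ++ rest)

⊆ₘ⇒count≤ : ∀ v {xs ys} → xs ⊆ₘ ys → count v xs ≤ count v ys
⊆ₘ⇒count≤ v {xs} (rest , xs++rest↭ys) =
  subst (count v xs ≤_) (trans (sym (count-++ v xs rest)) (count-↭ v xs++rest↭ys)) (m≤m+n (count v xs) (count v rest))

⊆ₘ⇒∈ : ∀ {x xs ys} → xs ⊆ₘ ys → x ∈ xs → x ∈ ys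
⊆ₘ⇒∈ (rest , xs++rest↭ys) x∈xs = ∈-resp-↭ xs++rest↭ys (∈-++⁺ˡ x∈xs)

rareParts commonParts candidateParts : List ℕ
rareParts      = 1 ∷ 3 ∷ 4 ∷ 6 ∷ 9 ∷ 16 ∷ []
commonParts    = 7 ∷ 10 ∷ 13 ∷ []
candidateParts = rareParts ++ commonParts

-- For each x < 34 outside candidateParts, a strictly better multiset of the same size.
replacements : List (ℕ × List ℕ)
replacements =
    (2  , 1 ∷ 1 ∷ [])
  ∷ (5  , 4 ∷ 1 ∷ [])
  ∷ (8  , 4 ∷ 4 ∷ [])
  ∷ (11 , 7 ∷ 4 ∷ [])
  ∷ (12 , 4 ∷ 4 ∷ 4 ∷ [])
  ∷ (14 , 7 ∷ 7 ∷ [])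
  ∷ (15 , 7 ∷ 4 ∷ 4 ∷ [])
  ∷ (17 , 10 ∷ 7 ∷ [])
  ∷ (18 , 7 ∷ 7 ∷ 4 ∷ [])
  ∷ (19 , 7 ∷ 4 ∷ 4 ∷ 4 ∷ [])
  ∷ (20 , 13 ∷ 7 ∷ [])
  ∷ (21 , 7 ∷ 7 ∷ 7 ∷ [])
  ∷ (22 , 7 ∷ 7 ∷ 4 ∷ 4 ∷ [])
  ∷ (23 , 13 ∷ 10 ∷ [])
  ∷ (24 , 10 ∷ 7 ∷ 7 ∷ [])
  ∷ (25 , 7 ∷ 7 ∷ 7 ∷ 4 ∷ [])
  ∷ (26 , 13 ∷ 13 ∷ [])
  ∷ (27 , 13 ∷ 7 ∷ 7 ∷ [])
  ∷ (28 , 7 ∷ 7 ∷ 7 ∷ 7 ∷ [])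
  ∷ (29 , 7 ∷ 7 ∷ 7 ∷ 4 ∷ 4 ∷ [])
  ∷ (30 , 13 ∷ 10 ∷ 7 ∷ [])
  ∷ (31 , 10 ∷ 7 ∷ 7 ∷ 7 ∷ [])
  ∷ (32 , 7 ∷ 7 ∷ 7 ∷ 7 ∷ 4 ∷ [])
  ∷ (33 , 13 ∷ 13 ∷ 7 ∷ [])
  ∷ []

replacementOf : ℕ → List ℕ
replacementOf x = go replacements
  where
  go : List (ℕ × List ℕ) → List ℕ
  go []             = []
  go ((y , R) ∷ ys) = if x ≡ᵇ y then R else go ys

candidateOrReplaceable : ℕ → Bool
candidateOrReplaceable x = any (x ≡ᵇ_) candidateParts ∨ improvement? [ x ] (replacementOf x)

candidateOrReplaceable-sound : ∀ x → T (candidateOrReplaceable x) →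
                               x ∈ candidateParts ⊎ Improvement [ x ] (replacementOf x)
candidateOrReplaceable-sound x holds with Equivalence.to T-∨ holds
... | inj₁ candidate  = inj₁ (Any.map (≡ᵇ⇒≡ x _) (any⁻ (x ≡ᵇ_) candidateParts candidate))
... | inj₂ replaceable = inj₂ (improvement?-sound [ x ] (replacementOf x) replaceable)

smallPart-candidateOrReplaceable : ∀ {x} → x < 33 →
  suc x ∈ candidateParts ⊎ Improvement [ suc x ] (replacementOf (suc x))
smallPart-candidateOrReplaceable x<33 = All.lookup checked (∈-upTo⁺ x<33)
  where
  checked : All (λ x → suc x ∈ candidateParts ⊎ Improvement [ suc x ] (replacementOf (suc x))) (upTo 33)
  checked = All.map (candidateOrReplaceable-sound _) (all⁺ (candidateOrReplaceable ∘ suc) (upTo 33) _)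

largePart-improvement : ∀ {x} → 34 ≤ x → Improvement [ x ] (parts (shapeOfWeight ((x ∸ 34) / 7) ((x ∸ 34) % 7)))
largePart-improvement {x} 34≤x =
  trans (sum-parts σ) (trans weight≡x (sym (+-identityʳ x))) ,
  parts-positive σ ,
  (begin-strict
    N03 x * 1          ≡⟨ *-identityʳ (N03 x) ⟩
    N03 x              ≤⟨ N03≤p x ⟩
    p x x              <⟨ subst (λ w → p w w < value σ) weight≡x (p<value q s<7) ⟩
    value σ            ≡⟨ N03-part-parts σ ⟨
    N03-part (parts σ) ∎)
  where
  open ≤-Reasoning
  y = x ∸ 34
  q = y / 7
  s = y % 7
  σ = shapeOfWeight q s
  s<7 : s < 7
  s<7 = m%n<n y 7
  weight≡x : weight σ ≡ x
  weight≡x = begin-equality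
    weight σ           ≡⟨ weight-shapeOfWeight q s<7 ⟩
    7 * q + (34 + s)   ≡⟨ solve 2 (λ q s → con 7 :* q :+ (con 34 :+ s) := con 34 :+ (s :+ q :* con 7)) refl q s ⟩
    34 + (s + q * 7)   ≡⟨ cong (34 +_) (m≡m%n+[m/n]*n y 7) ⟨
    34 + y             ≡⟨ m+[n∸m]≡n 34≤x ⟩
    x                  ∎

module Maximiser {n λs} (n≥33 : 33 ≤ n) (isPartition : IsPartition n λs) (maximal : IsMaximal n λs) where

  C : ℕ → ℕ
  C v = count v λs

  ¬improvable : ∀ {S} R → S ⊆ₘ λs → ¬ Improvement S R
  ¬improvable R S⊆λs = maximal⇒¬improvement isPartition maximal {R = R} S⊆λs

  count≤₁ : ∀ u a R → T (improvement? (replicate (suc a) u) R) → C u ≤ a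
  count≤₁ u a R better = ≮⇒≥ λ a<C →
    ¬improvable R (replicate-⊆ₘ u (suc a) a<C) (improvement?-sound (replicate (suc a) u) R better)

  count≤₂ : ∀ u a w b R → u ≢ w → a ≤ C u → T (improvement? (replicate a u ++ replicate (suc b) w) R) → C w ≤ b
  count≤₂ u a w b R u≢w a≤C better = ≮⇒≥ λ b<C →
    ¬improvable R (replicate²-⊆ₘ a (suc b) u≢w a≤C b<C) (improvement?-sound (replicate a u ++ replicate (suc b) w) R better)

  part-candidate : ∀ {x} → x ∈ λs → x ∈ candidateParts
  part-candidate {zero}  x∈λs with () ← All.lookup (proj₁ (proj₂ isPartition)) x∈λs
  part-candidate {suc y} x∈λs with y <? 33
  ... | no  y≮33 = ⊥-elim (¬improvable _ (∈⇒[]⊆ₘ x∈λs) (largePart-improvement (s≤s (≮⇒≥ y≮33))))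
  ... | yes y<33 = [ id , (λ improvable → ⊥-elim (¬improvable (replacementOf (suc y)) (∈⇒[]⊆ₘ x∈λs) improvable)) ]′
                     (smallPart-candidateOrReplaceable y<33)

  n≤weightedBound : ∀ {bs} → Pointwise (λ v b → C v ≤ b) candidateParts bs → n ≤ sum (zipWith _*_ candidateParts bs)
  n≤weightedBound {bs} bounds = begin
    n                                      ≡⟨ proj₁ isPartition ⟨
    sum λs                                 ≤⟨ sum≤weightedCount candidateParts (All.tabulate part-candidate) ⟩
    weightedCount candidateParts λs        ≤⟨ weightedCount≤ {xs = λs} bounds ⟩
    sum (zipWith _*_ candidateParts bs)    ∎
    where open ≤-Reasoning

  boundsTooSmall : ∀ bs → Pointwise (λ v b → C v ≤ b) candidateParts bs → T (sum (zipWith _*_ candidateParts bs) <ᵇ 33) → ⊥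
  boundsTooSmall bs bounds small = <⇒≱ (<ᵇ⇒< (sum (zipWith _*_ candidateParts bs)) 33 small) (≤-trans n≥33 (n≤weightedBound bounds))

  -- If v occurs, exchanges involving v bound every count, and then n = Σ v · C v < 33.
  no-1s : C 1 ≤ 0
  no-1s = ≮⇒≥ λ 1≤C1 → boundsTooSmall (3 ∷ 0 ∷ 1 ∷ 0 ∷ 0 ∷ 0 ∷ 0 ∷ 0 ∷ 0 ∷ [])
    ( count≤₁ 1 3 (4 ∷ []) _
    ∷ count≤₂ 1 1 3  0 (4 ∷ [])      (λ ()) 1≤C1 _
    ∷ count≤₂ 1 1 4  1 (9 ∷ [])      (λ ()) 1≤C1 _
    ∷ count≤₂ 1 1 6  0 (7 ∷ [])      (λ ()) 1≤C1 _
    ∷ count≤₂ 1 1 9  0 (10 ∷ [])     (λ ()) 1≤C1 _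
    ∷ count≤₂ 1 1 16 0 (10 ∷ 7 ∷ []) (λ ()) 1≤C1 _
    ∷ count≤₂ 1 1 7  0 (4 ∷ 4 ∷ [])  (λ ()) 1≤C1 _
    ∷ count≤₂ 1 1 10 0 (7 ∷ 4 ∷ [])  (λ ()) 1≤C1 _
    ∷ count≤₂ 1 1 13 0 (7 ∷ 7 ∷ [])  (λ ()) 1≤C1 _
    ∷ []) _

  no-3s : C 3 ≤ 0
  no-3s = ≮⇒≥ λ 1≤C3 → boundsTooSmall (0 ∷ 1 ∷ 0 ∷ 0 ∷ 0 ∷ 0 ∷ 0 ∷ 0 ∷ 0 ∷ [])
    ( no-1s
    ∷ count≤₁ 3 1 (6 ∷ []) _
    ∷ count≤₂ 3 1 4  0 (7 ∷ [])              (λ ()) 1≤C3 _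
    ∷ count≤₂ 3 1 6  0 (9 ∷ [])              (λ ()) 1≤C3 _
    ∷ count≤₂ 3 1 9  0 (4 ∷ 4 ∷ 4 ∷ [])      (λ ()) 1≤C3 _
    ∷ count≤₂ 3 1 16 0 (7 ∷ 4 ∷ 4 ∷ 4 ∷ [])  (λ ()) 1≤C3 _
    ∷ count≤₂ 3 1 7  0 (10 ∷ [])             (λ ()) 1≤C3 _
    ∷ count≤₂ 3 1 10 0 (13 ∷ [])             (λ ()) 1≤C3 _
    ∷ count≤₂ 3 1 13 0 (16 ∷ [])             (λ ()) 1≤C3 _
    ∷ []) _

  no-6s : C 6 ≤ 0
  no-6s = ≮⇒≥ λ 1≤C6 → boundsTooSmall (0 ∷ 0 ∷ 0 ∷ 1 ∷ 0 ∷ 0 ∷ 0 ∷ 0 ∷ 0 ∷ [])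
    ( no-1s
    ∷ no-3s
    ∷ count≤₂ 6 1 4  0 (10 ∷ [])             (λ ()) 1≤C6 _
    ∷ count≤₁ 6 1 (4 ∷ 4 ∷ 4 ∷ []) _
    ∷ count≤₂ 6 1 9  0 (7 ∷ 4 ∷ 4 ∷ [])      (λ ()) 1≤C6 _
    ∷ count≤₂ 6 1 16 0 (7 ∷ 7 ∷ 4 ∷ 4 ∷ [])  (λ ()) 1≤C6 _
    ∷ count≤₂ 6 1 7  0 (13 ∷ [])             (λ ()) 1≤C6 _
    ∷ count≤₂ 6 1 10 0 (16 ∷ [])             (λ ()) 1≤C6 _
    ∷ count≤₂ 6 1 13 0 (7 ∷ 4 ∷ 4 ∷ 4 ∷ [])  (λ ()) 1≤C6 _
    ∷ []) _

  no-9s : C 9 ≤ 0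
  no-9s = ≮⇒≥ λ 1≤C9 → boundsTooSmall (0 ∷ 0 ∷ 0 ∷ 0 ∷ 1 ∷ 0 ∷ 0 ∷ 0 ∷ 0 ∷ [])
    ( no-1s
    ∷ no-3s
    ∷ count≤₂ 9 1 4  0 (13 ∷ [])             (λ ()) 1≤C9 _
    ∷ no-6s
    ∷ count≤₁ 9 1 (7 ∷ 7 ∷ 4 ∷ []) _
    ∷ count≤₂ 9 1 16 0 (7 ∷ 7 ∷ 7 ∷ 4 ∷ [])  (λ ()) 1≤C9 _
    ∷ count≤₂ 9 1 7  0 (16 ∷ [])             (λ ()) 1≤C9 _
    ∷ count≤₂ 9 1 10 0 (7 ∷ 4 ∷ 4 ∷ 4 ∷ [])  (λ ()) 1≤C9 _
    ∷ count≤₂ 9 1 13 0 (7 ∷ 7 ∷ 4 ∷ 4 ∷ [])  (λ ()) 1≤C9 _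
    ∷ []) _

  no-16s : C 16 ≤ 0
  no-16s = ≮⇒≥ λ 1≤C16 → boundsTooSmall (0 ∷ 0 ∷ 0 ∷ 0 ∷ 0 ∷ 1 ∷ 0 ∷ 0 ∷ 0 ∷ [])
    ( no-1s
    ∷ no-3s
    ∷ count≤₂ 16 1 4  0 (13 ∷ 7 ∷ [])            (λ ()) 1≤C16 _
    ∷ no-6s
    ∷ no-9s
    ∷ count≤₁ 16 1 (7 ∷ 7 ∷ 7 ∷ 7 ∷ 4 ∷ []) _
    ∷ count≤₂ 16 1 7  0 (13 ∷ 10 ∷ [])           (λ ()) 1≤C16 _
    ∷ count≤₂ 16 1 10 0 (13 ∷ 13 ∷ [])           (λ ()) 1≤C16 _
    ∷ count≤₂ 16 1 13 0 (7 ∷ 7 ∷ 7 ∷ 4 ∷ 4 ∷ []) (λ ()) 1≤C16 _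
    ∷ []) _

  no-4s : C 4 ≤ 0
  no-4s = ≮⇒≥ λ 1≤C4 → count4≢ (C 4) 1≤C4 (count≤₁ 4 4 (13 ∷ 7 ∷ []) _) ≤-refl ≤-refl
    where
    bounds : ∀ {c b} → 1 ≤ C 4 → C 4 ≤ c → C 7 ≤ b →
             Pointwise (λ v b → C v ≤ b) candidateParts (0 ∷ 0 ∷ c ∷ 0 ∷ 0 ∷ 0 ∷ b ∷ 0 ∷ 0 ∷ [])
    bounds 1≤C4 C4≤c C7≤b =
      no-1s ∷ no-3s ∷ C4≤c ∷ no-6s ∷ no-9s ∷ no-16s ∷ C7≤b
      ∷ count≤₂ 4 1 10 0 (7 ∷ 7 ∷ [])  (λ ()) 1≤C4 _
      ∷ count≤₂ 4 1 13 0 (10 ∷ 7 ∷ []) (λ ()) 1≤C4 _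
      ∷ []
    count4≢ : ∀ c → 1 ≤ c → c ≤ 4 → c ≤ C 4 → C 4 ≤ c → ⊥
    count4≢ 1 _ _ c≤C C≤c = boundsTooSmall _ (bounds c≤C C≤c (count≤₂ 4 1 7 4 (13 ∷ 13 ∷ 13 ∷ []) (λ ()) c≤C _)) _
    count4≢ 2 _ _ c≤C C≤c = boundsTooSmall _ (bounds (≤-trans (s≤s z≤n) c≤C) C≤c (count≤₂ 4 2 7 3 (13 ∷ 13 ∷ 10 ∷ []) (λ ()) c≤C _)) _
    count4≢ 3 _ _ c≤C C≤c = boundsTooSmall _ (bounds (≤-trans (s≤s z≤n) c≤C) C≤c (count≤₂ 4 3 7 1 (13 ∷ 13 ∷ []) (λ ()) c≤C _)) _
    count4≢ 4 _ _ c≤C C≤c = boundsTooSmall _ (bounds (≤-trans (s≤s z≤n) c≤C) C≤c (count≤₂ 4 4 7 0 (13 ∷ 10 ∷ []) (λ ()) c≤C _)) _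
    count4≢ (suc (suc (suc (suc (suc _))))) _ (s≤s (s≤s (s≤s (s≤s ())))) _ _

  at-most-one-10 : C 10 ≤ 1
  at-most-one-10 = count≤₁ 10 1 (13 ∷ 7 ∷ []) _

  at-most-three-13s : C 13 ≤ 3
  at-most-three-13s = count≤₁ 13 3 (10 ∷ 7 ∷ 7 ∷ 7 ∷ 7 ∷ 7 ∷ 7 ∷ []) _

  10⇒at-most-two-13s : 1 ≤ C 10 → C 13 ≤ 2
  10⇒at-most-two-13s 1≤C10 = count≤₂ 10 1 13 2 (7 ∷ 7 ∷ 7 ∷ 7 ∷ 7 ∷ 7 ∷ 7 ∷ []) (λ ()) 1≤C10 _

  part-common : ∀ {x} → x ∈ λs → x ∈ commonParts
  part-common {x} x∈λs with ∈-++⁻ rareParts (part-candidate x∈λs)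
  ... | inj₂ common = common
  ... | inj₁ rare   = ⊥-elim (<⇒≱ (∈⇒count-pos x∈λs) (All.lookup absent rare))
    where
    absent : All (λ v → C v ≤ 0) rareParts
    absent = no-1s ∷ no-3s ∷ no-4s ∷ no-6s ∷ no-9s ∷ no-16s ∷ []

10≱13 : ¬ 10 ≥ 13
10≱13 = <⇒≱ (m≤m+n 11 2)

classify-10s-13s : ∀ as → as ≢ [] → Linked _≥_ as → All (λ a → a ≡ 10 ⊎ a ≡ 13) as
  → count 10 as ≤ 1 → count 13 as ≤ 3 → (1 ≤ count 10 as → count 13 as ≤ 2)
  → as ∈ ((10 ∷ []) ∷ (13 ∷ []) ∷ (13 ∷ 10 ∷ []) ∷ (13 ∷ 13 ∷ [])
          ∷ (13 ∷ 13 ∷ 10 ∷ []) ∷ (13 ∷ 13 ∷ 13 ∷ []) ∷ [])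
classify-10s-13s [] as≢[] _ _ _ _ _ = ⊥-elim (as≢[] refl)
classify-10s-13s (_ ∷ []) _ _ (inj₁ refl ∷ []) _ _ _ = here refl
classify-10s-13s (_ ∷ []) _ _ (inj₂ refl ∷ []) _ _ _ = there (here refl)
classify-10s-13s (_ ∷ _ ∷ _) _ _ (inj₁ refl ∷ inj₁ refl ∷ _) (s≤s ()) _ _
classify-10s-13s (_ ∷ _ ∷ _) _ (10≥13 ∷ _) (inj₁ refl ∷ inj₂ refl ∷ _) _ _ _ = ⊥-elim (10≱13 10≥13)
classify-10s-13s (_ ∷ _ ∷ []) _ _ (inj₂ refl ∷ inj₁ refl ∷ []) _ _ _ = there (there (here refl))
classify-10s-13s (_ ∷ _ ∷ []) _ _ (inj₂ refl ∷ inj₂ refl ∷ []) _ _ _ = there (there (there (here refl)))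
classify-10s-13s (_ ∷ _ ∷ _ ∷ _) _ _ (inj₂ refl ∷ inj₁ refl ∷ inj₁ refl ∷ _) (s≤s ()) _ _
classify-10s-13s (_ ∷ _ ∷ _ ∷ _) _ (_ ∷ 10≥13 ∷ _) (inj₂ refl ∷ inj₁ refl ∷ inj₂ refl ∷ _) _ _ _ = ⊥-elim (10≱13 10≥13)
classify-10s-13s (_ ∷ _ ∷ _ ∷ []) _ _ (inj₂ refl ∷ inj₂ refl ∷ inj₁ refl ∷ []) _ _ _ = there (there (there (there (here refl))))
classify-10s-13s (_ ∷ _ ∷ _ ∷ []) _ _ (inj₂ refl ∷ inj₂ refl ∷ inj₂ refl ∷ []) _ _ _ = there (there (there (there (there (here refl)))))
classify-10s-13s (_ ∷ _ ∷ _ ∷ _ ∷ _) _ _ (inj₂ refl ∷ inj₂ refl ∷ inj₁ refl ∷ inj₁ refl ∷ _) (s≤s ()) _ _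
classify-10s-13s (_ ∷ _ ∷ _ ∷ _ ∷ _) _ (_ ∷ _ ∷ 10≥13 ∷ _) (inj₂ refl ∷ inj₂ refl ∷ inj₁ refl ∷ inj₂ refl ∷ _) _ _ _ = ⊥-elim (10≱13 10≥13)
classify-10s-13s (_ ∷ _ ∷ _ ∷ _ ∷ _) _ _ (inj₂ refl ∷ inj₂ refl ∷ inj₂ refl ∷ inj₁ refl ∷ _) _ _ 10⇒≤2 with 10⇒≤2 (s≤s z≤n)
... | s≤s (s≤s ())
classify-10s-13s (_ ∷ _ ∷ _ ∷ _ ∷ _) _ _ (inj₂ refl ∷ inj₂ refl ∷ inj₂ refl ∷ inj₂ refl ∷ _) _ (s≤s (s≤s (s≤s ()))) _

proposition3p7 : (n : ℕ) → 33 ≤ n → (λs : List ℕ) → IsPartition n λs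
    → ((μ : List ℕ) → IsPartition n μ → N03-part μ ≤ N03-part λs)
    → (as : List ℕ) → as ≢ [] → Linked _≥_ as → (∃ λ rest → (as ++ rest) ↭ λs)
    → All (λ a → a ≢ 7) as
    → as ∈ ((10 ∷ []) ∷ (13 ∷ []) ∷ (13 ∷ 10 ∷ []) ∷ (13 ∷ 13 ∷ [])
            ∷ (13 ∷ 13 ∷ 10 ∷ []) ∷ (13 ∷ 13 ∷ 13 ∷ []) ∷ [])
proposition3p7 n n≥33 λs isPartition maximal as as≢[] decreasing as⊆λs no-7s =
  classify-10s-13s as as≢[] decreasing (All.zipWith 10-or-13 (All.tabulate (part-common ∘ ⊆ₘ⇒∈ as⊆λs) , no-7s))
    (≤-trans (⊆ₘ⇒count≤ 10 as⊆λs) at-most-one-10)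
    (≤-trans (⊆ₘ⇒count≤ 13 as⊆λs) at-most-three-13s)
    (λ 1≤#10 → ≤-trans (⊆ₘ⇒count≤ 13 as⊆λs) (10⇒at-most-two-13s (≤-trans 1≤#10 (⊆ₘ⇒count≤ 10 as⊆λs))))
  where
  open Maximiser n≥33 isPartition maximal
  10-or-13 : ∀ {a} → a ∈ commonParts × a ≢ 7 → a ≡ 10 ⊎ a ≡ 13
  10-or-13 (here refl                 , a≢7) = ⊥-elim (a≢7 refl)
  10-or-13 (there (here refl)         , _)   = inj₁ refl
  10-or-13 (there (there (here refl)) , _)   = inj₂ refl
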